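{- Let $\mathcal{D}=(X,\mathcal{B})$ be a design with $v$ points, $b$ blocks and $v\times b$ point-by-block incidence matrix $A$, let $p$ be a prime, and let $C$ be the linear code of length $v$ over $GF(p)$ spanned by the columns of $A$. If the minimum Hamming weight of $C$ is $d$, then for every block $B$ of $\mathcal{D}$ with $|B|=d$, the residual design $\mathcal{D}_B$ is linearly embeddable over $GF(p)$.
   Context: A design (incidence structure) is a pair $(X,\mathcal{B})$ of a finite point set $X=\{x_1,\dots,x_v\}$ and a collection $\mathcal{B}=\{B_1,\dots,B_b\}$ of subsets of $X$ (blocks); its point-by-block incidence matrix $A=(a_{ij})$ has $a_{ij}=1$ if $x_i\in B_j$ and $0$ otherwise. For a block $B$, the residual design $\mathcal{D}_B$ has point set $X\setminus B$ and blocks $B_j\setminus B$ for all blocks $B_j\neq B$ (as a collection, one for each such $B_j$). For a prime $p$, $\mathrm{rank}_p$ denotes rank over $GF(p)$. The residual design $\mathcal{D}_B$ is called linearly embeddable over $GF(p)$ if $\mathrm{rank}_p A=\mathrm{rank}_p A''+1$, where $A$ is the incidence matrix of $\mathcal{D}$ and $A''$ is the incidence matrix of $\mathcal{D}_B$. -}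

module Defs where

open import Data.Bool using (Bool; true; false; not; if_then_else_)
open import Data.Nat using (ℕ; zero; suc; _+_; _*_; _≤_)
open import Data.Nat.Divisibility using (_∣_; _∣?_)
open import Data.Fin using (Fin; zero; suc)
open import Data.Fin.Subset using (Subset; _∈_; _∉_; ∣_∣)
open import Data.List using (List; length; filter; filterᵇ; allFin; lookup)
open import Data.Product using (Σ; _×_; ∃)
open import Relation.Nullary using (¬_; ¬?)
open import Relation.Binary.PropositionalEquality using (_≡_; _≢_)
open import Data.Fin using (_≟_)

-- An incidence matrix with m rows (points) and n columns (blocks):
-- entry true = "point i lies in block j".
Incidence : ℕ → ℕ → Set
Incidence m n = Fin m → Fin n → Bool

⟦_⟧ : Bool → ℕ
⟦ true ⟧ = 1
⟦ false ⟧ = 0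

sumFin : ∀ {n} → (Fin n → ℕ) → ℕ
sumFin {zero} f = 0
sumFin {suc n} f = f zero + sumFin (λ i → f (suc i))

-- Elements of GF(p) are represented by natural numbers modulo p:
-- x represents 0 in GF(p) iff p ∣ x.

lincomb : ∀ {m n} → Incidence m n → (Fin n → ℕ) → Fin m → ℕ
lincomb M c i = sumFin (λ j → c j * ⟦ M i j ⟧)

LinIndep : ℕ → ∀ {m n} → Incidence m n → Subset n → Set
LinIndep p {m} {n} M S =
  (c : Fin n → ℕ) →
  (∀ j → j ∉ S → c j ≡ 0) →
  (∀ i → p ∣ lincomb M c i) →
  ∀ j → p ∣ c j

HasRank : ℕ → ∀ {m n} → Incidence m n → ℕ → Set
HasRank p {m} {n} M r =
  (Σ (Subset n) λ S → LinIndep p M S × ∣ S ∣ ≡ r) ×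
  (∀ (S : Subset n) → LinIndep p M S → ∣ S ∣ ≤ r)

weight : ℕ → ∀ {m} → (Fin m → ℕ) → ℕ
weight p {m} w = length (filter (λ i → ¬? (p ∣? w i)) (allFin m))

-- The code C spanned over GF(p) by the columns of M has minimum weight d:
-- codewords are exactly the vectors lincomb M c (mod p).
MinWeight : ℕ → ∀ {m n} → Incidence m n → ℕ → Set
MinWeight p {m} {n} M d =
  (Σ (Fin n → ℕ) λ c → (¬ (∀ i → p ∣ lincomb M c i)) × weight p (lincomb M c) ≡ d) ×
  (∀ (c : Fin n → ℕ) → ¬ (∀ i → p ∣ lincomb M c i) → d ≤ weight p (lincomb M c))

blockSize : ∀ {m n} → Incidence m n → Fin n → ℕ
blockSize {m} M j = length (filterᵇ (λ i → M i j) (allFin m))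

-- Residual design w.r.t. block j: points = points not in block j (listed in
-- increasing order), blocks = B_k \ B_j for every block index k ≠ j.
residualPoints : ∀ {m n} → Incidence m n → Fin n → List (Fin m)
residualPoints {m} M j = filterᵇ (λ i → not (M i j)) (allFin m)

residualBlocks : ∀ {n} → Fin n → List (Fin n)
residualBlocks {n} j = filter (λ k → ¬? (k ≟ j)) (allFin n)

residual : ∀ {m n} (M : Incidence m n) (j : Fin n) →
           Incidence (length (residualPoints M j)) (length (residualBlocks j))
residual M j r c = M (lookup (residualPoints M j) r) (lookup (residualBlocks j) c)

LinearlyEmbeddable : ℕ → ∀ {m n} → Incidence m n → Fin n → Set
LinearlyEmbeddable p M j = ∃ λ r → HasRank p M (suc r) × HasRank p (residual M j) r

{-# OPTIONS --safe #-}
-- Let B be the block j, of size d. Deleting the rows of B kills column j, and up to multiples of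
-- column j it kills no codeword: a codeword w vanishing outside B and nonzero at some i₀ ∈ B gives
-- w - w(i₀)·(column j), a codeword supported in B ∖ {i₀}, of weight < d, hence zero. So every
-- relation among the columns of A″ extends to a relation among the columns of A. Consequently an
-- independent set of A″ together with column j is independent in A, and conversely an independent
-- set of columns of A stays independent in A″ after removing column j and at most one more column,
-- since the relations it acquires in A″ form at most a line.
module Submission where

open import Defs
open import Data.Bool as Bool using (true; false; not; T; if_then_else_)
open import Data.Bool.Properties using (T?; ¬-not)
open import Data.Fin using (Fin; zero; suc; toℕ; _≟_)
open import Data.Fin.Properties using (all?; any?; ¬∀⟶∃¬)
open import Data.Fin.Subset using (Subset; _∈_; _∉_; ∣_∣)
open import Data.Fin.Subset.Properties using (_∈?_; anySubset?; ∣p∣≤n; ∣⊥∣≡0; ∉⊥)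
open import Data.List as List using (List; []; _∷_; length; filter; allFin)
open import Data.List.Membership.Propositional using () renaming (_∈_ to _∈ₗ_)
open import Data.List.Membership.Propositional.Properties using (∈-lookup; ∈-filter⁺; ∈-filter⁻; ∈-allFin)
open import Data.List.Properties using (filter-some; filter-none; map-tabulate)
import Data.List.Relation.Unary.All as All
open import Data.List.Relation.Unary.Any as Any using (here; there)
open import Data.List.Relation.Unary.Any.Properties using (lookup-index)
open import Data.List.Relation.Unary.AllPairs using (_∷_)
open import Data.List.Relation.Unary.Unique.Propositional using (Unique)
open import Data.List.Relation.Unary.Unique.Propositional.Properties using (filter⁺; allFin⁺)
open import Data.Nat using (ℕ; zero; suc; _+_; _*_; _≤_; _<_; z≤n; s≤s; s≤s⁻¹; NonZero)
open import Data.Nat.Properties renaming (_≟_ to _≟ℕ_)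
open import Algebra.Properties.CommutativeSemigroup +-commutativeSemigroup using (interchange)
open import Data.Nat.Divisibility
open import Data.Nat.ListAction using (sum)
open import Data.Nat.DivMod using (_divMod_; module DivMod)
open import Data.Nat.Primality using (Prime; euclidsLemma; ¬prime[0]; ¬prime[1])
open import Data.Nat.Tactic.RingSolver using (solve-∀)
open import Data.Product using (∃; _×_; _,_; proj₁; proj₂)
open import Data.Sum using (_⊎_; inj₁; inj₂; [_,_]′)
open import Data.Vec as Vec using (Vec; []; _∷_; tabulate; _[_]≔_)
open import Data.Vec.Properties using (lookup∘tabulate; tabulate-cong; tabulate∘lookup; []=⇒lookup; lookup⇒[]=; lookup∘update; lookup∘update′)
open import Function using (_∘_; id)
open import Level using (0ℓ)
open import Relation.Nullary using (¬_; Dec; yes; no; does; ¬?; contradiction)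
open import Relation.Nullary.Decidable using (map′; _×-dec_; _→-dec_)
open import Relation.Unary using (Pred; Decidable)
open import Relation.Binary.PropositionalEquality

-- Sums and linear combinations

sumFin-cong : ∀ {n} {f g : Fin n → ℕ} → (∀ k → f k ≡ g k) → sumFin f ≡ sumFin g
sumFin-cong {zero}  f≗g = refl
sumFin-cong {suc n} f≗g = cong₂ _+_ (f≗g zero) (sumFin-cong (f≗g ∘ suc))

sumFin-+ : ∀ {n} (f g : Fin n → ℕ) → sumFin (λ k → f k + g k) ≡ sumFin f + sumFin g
sumFin-+ {zero}  f g = refl
sumFin-+ {suc n} f g = trans
  (cong (f zero + g zero +_) (sumFin-+ (f ∘ suc) (g ∘ suc)))
  (interchange (f zero) (g zero) (sumFin (f ∘ suc)) (sumFin (g ∘ suc)))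

sumFin-* : ∀ {n} x (f : Fin n → ℕ) → sumFin (λ k → x * f k) ≡ x * sumFin f
sumFin-* {zero}  x f = sym (*-zeroʳ x)
sumFin-* {suc n} x f = trans
  (cong (x * f zero +_) (sumFin-* x (f ∘ suc)))
  (sym (*-distribˡ-+ x (f zero) (sumFin (f ∘ suc))))

sumFin-∣ : ∀ {n d} (f : Fin n → ℕ) → (∀ k → d ∣ f k) → d ∣ sumFin f
sumFin-∣ {zero}  f d∣f = _ ∣0
sumFin-∣ {suc n} f d∣f = ∣m∣n⇒∣m+n (d∣f zero) (sumFin-∣ (f ∘ suc) (d∣f ∘ suc))

sumFin-tabulate : ∀ {n} (f : Fin n → ℕ) → sumFin f ≡ sum (List.tabulate f)
sumFin-tabulate {zero}  f = refl
sumFin-tabulate {suc n} f = cong (f zero +_) (sumFin-tabulate (f ∘ suc))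

sumFin-lookup : ∀ {A : Set} (xs : List A) (g : A → ℕ) → sumFin (g ∘ List.lookup xs) ≡ sum (List.map g xs)
sumFin-lookup []       g = refl
sumFin-lookup (x ∷ xs) g = cong (g x +_) (sumFin-lookup xs g)

vanishAt : ∀ {n} → Fin n → (Fin n → ℕ) → Fin n → ℕ
vanishAt j g k = if does (k ≟ j) then 0 else g k

sum-vanishAt : ∀ {n} (j : Fin n) (g : Fin n → ℕ) (xs : List (Fin n)) →
  sum (List.map (vanishAt j g) xs) ≡ sum (List.map g (filter (λ k → ¬? (k ≟ j)) xs))
sum-vanishAt j g []       = refl
sum-vanishAt j g (k ∷ xs) with k ≟ j
... | yes _ = sum-vanishAt j g xs
... | no  _ = cong (g k +_) (sum-vanishAt j g xs)

sumFin-pick : ∀ {n} (j : Fin n) (g : Fin n → ℕ) → sumFin g ≡ g j + sumFin (vanishAt j g)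
sumFin-pick {suc n} zero    g = refl
sumFin-pick {suc n} (suc j) g = begin
  g zero + sumFin (g ∘ suc)                              ≡⟨ cong (g zero +_) (sumFin-pick j (g ∘ suc)) ⟩
  g zero + (g (suc j) + sumFin (vanishAt j (g ∘ suc)))   ≡⟨ x+[y+z]≡y+[x+z] (g zero) (g (suc j)) _ ⟩
  g (suc j) + (g zero + sumFin (vanishAt j (g ∘ suc)))   ≡⟨ cong (λ s → g (suc j) + (g zero + s)) (sumFin-cong vanish-suc) ⟩
  g (suc j) + sumFin (vanishAt (suc j) g)                ∎
  where
  open ≡-Reasoning
  x+[y+z]≡y+[x+z] : ∀ x y z → x + (y + z) ≡ y + (x + z)
  x+[y+z]≡y+[x+z] = solve-∀
  vanish-suc : ∀ k → vanishAt j (g ∘ suc) k ≡ vanishAt (suc j) g (suc k)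
  vanish-suc k with k ≟ j
  ... | yes _ = refl
  ... | no  _ = refl

lincomb-cong : ∀ {m n} (M : Incidence m n) {a b : Fin n → ℕ} → (∀ k → a k ≡ b k) →
  ∀ i → lincomb M a i ≡ lincomb M b i
lincomb-cong M a≗b i = sumFin-cong (λ k → cong (_* ⟦ M i k ⟧) (a≗b k))

lincomb-+ : ∀ {m n} (M : Incidence m n) (a b : Fin n → ℕ) →
  ∀ i → lincomb M (λ k → a k + b k) i ≡ lincomb M a i + lincomb M b i
lincomb-+ M a b i = trans
  (sumFin-cong (λ k → *-distribʳ-+ ⟦ M i k ⟧ (a k) (b k)))
  (sumFin-+ (λ k → a k * ⟦ M i k ⟧) (λ k → b k * ⟦ M i k ⟧))

lincomb-* : ∀ {m n} (M : Incidence m n) x (a : Fin n → ℕ) →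
  ∀ i → lincomb M (λ k → x * a k) i ≡ x * lincomb M a i
lincomb-* M x a i = trans
  (sumFin-cong (λ k → *-assoc x (a k) ⟦ M i k ⟧))
  (sumFin-* x (λ k → a k * ⟦ M i k ⟧))

lincomb-∣ : ∀ {m n d} (M : Incidence m n) (a : Fin n → ℕ) → (∀ k → d ∣ a k) → ∀ i → d ∣ lincomb M a i
lincomb-∣ M a d∣a i = sumFin-∣ (λ k → a k * ⟦ M i k ⟧) (λ k → ∣m⇒∣m*n ⟦ M i k ⟧ (d∣a k))

-- Independence of columns over GF(p)

IsRelation : ℕ → ∀ {m n} → Incidence m n → (Fin n → ℕ) → Set
IsRelation p M c = ∀ i → p ∣ lincomb M c i

SupportedIn : ∀ {n} → Subset n → (Fin n → ℕ) → Set
SupportedIn S c = ∀ k → k ∉ S → c k ≡ 0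

module _ {p m n : ℕ} {M : Incidence m n} where

  IsRelation-linear : ∀ x y {a b} → IsRelation p M a → IsRelation p M b →
    IsRelation p M (λ k → x * a k + y * b k)
  IsRelation-linear x y {a} {b} a-rel b-rel i = subst (p ∣_)
    (sym (trans (lincomb-+ M (λ k → x * a k) (λ k → y * b k) i)
                (cong₂ _+_ (lincomb-* M x a i) (lincomb-* M y b i))))
    (∣m∣n⇒∣m+n (∣n⇒∣m*n x (a-rel i)) (∣n⇒∣m*n y (b-rel i)))

  IsRelation-cong : ∀ {a b} → (∀ k → a k ≡ b k) → IsRelation p M a → IsRelation p M b
  IsRelation-cong a≗b a-rel i = subst (p ∣_) (lincomb-cong M a≗b i) (a-rel i)

  IsRelation-cancel : ∀ {a b c} → (∀ k → c k ≡ b k + a k) → (∀ k → p ∣ b k) →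
    IsRelation p M c → IsRelation p M a
  IsRelation-cancel {a} {b} c≡b+a p∣b c-rel i = ∣m+n∣m⇒∣n
    (subst (p ∣_) (trans (lincomb-cong M c≡b+a i) (lincomb-+ M b a i)) (c-rel i))
    (lincomb-∣ M b p∣b i)

LinIndepMod : ℕ → ∀ {m n} → Incidence m n → Subset n → Set
LinIndepMod p {n = n} M S =
  (c : Fin n → ℕ) → (∀ k → k ∉ S → p ∣ c k) → IsRelation p M c → ∀ k → p ∣ c k

LinIndep⇒LinIndepMod : ∀ {p m n} {M : Incidence m n} {S} → LinIndep p M S → LinIndepMod p M S
LinIndep⇒LinIndepMod {p} {n = n} {M} {S} indep c c-supp c-rel k =
  subst (p ∣_) (sym (c≡off+on k)) (∣m∣n⇒∣m+n (p∣off k) (indep on on-supp on-rel k))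
  where
  on off : Fin n → ℕ
  on  k = if does (k ∈? S) then c k else 0
  off k = if does (k ∈? S) then 0 else c k
  c≡off+on : ∀ k → c k ≡ off k + on k
  c≡off+on k with k ∈? S
  ... | yes _ = refl
  ... | no  _ = sym (+-identityʳ (c k))
  p∣off : ∀ k → p ∣ off k
  p∣off k with k ∈? S
  ... | yes _   = p ∣0
  ... | no  k∉S = c-supp k k∉S
  on-supp : SupportedIn S on
  on-supp k k∉S with k ∈? S
  ... | yes k∈S = contradiction k∈S k∉S
  ... | no  _   = refl
  on-rel : IsRelation p M on
  on-rel = IsRelation-cancel c≡off+on p∣off c-rel

Searchable : Set → Set₁
Searchable A = ∀ {P : Pred A 0ℓ} → Decidable P → Dec (∃ P)

any-Vec? : ∀ {A : Set} → Searchable A → ∀ n → Searchable (Vec A n)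
any-Vec? any-A? zero    P? = map′ ([] ,_) (λ { ([] , P[]) → P[] }) (P? [])
any-Vec? any-A? (suc n) P? = map′
  (λ (a , v , Pav) → a ∷ v , Pav) (λ { (a ∷ v , Pav) → a , v , Pav })
  (any-A? (λ a → any-Vec? any-A? n (λ v → P? (a ∷ v))))

greatest : ∀ {P : Pred ℕ 0ℓ} → Decidable P → ∀ n → P 0 → (∀ k → P k → k ≤ n) →
  ∃ λ r → P r × (∀ k → P k → k ≤ r)
greatest P? zero    P0 ≤n = 0 , P0 , ≤n
greatest {P} P? (suc n) P0 ≤1+n with P? (suc n)
... | yes P[1+n] = suc n , P[1+n] , ≤1+n
... | no ¬P[1+n] = greatest P? n P0 λ k Pk →
  s≤s⁻¹ (≤∧≢⇒< (≤1+n k Pk) (λ { refl → ¬P[1+n] Pk }))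

module _ (p : ℕ) .{{_ : NonZero p}} {m n : ℕ} (M : Incidence m n) where

  coeffs : Vec (Fin p) n → Fin n → ℕ
  coeffs v k = toℕ (Vec.lookup v k)

  -- Coefficients from Fin p suffice to witness dependence, which makes it decidable.
  Dependence : Subset n → Set
  Dependence S = ∃ λ v → SupportedIn S (coeffs v) × IsRelation p M (coeffs v) × ∃ λ k → ¬ p ∣ coeffs v k

  Dependence? : ∀ S → Dec (Dependence S)
  Dependence? S = any-Vec? any? n λ v →
    all? (λ k → ¬? (k ∈? S) →-dec (coeffs v k ≟ℕ 0)) ×-dec
    all? (λ i → p ∣? lincomb M (coeffs v) i) ×-dec
    any? (λ k → ¬? (p ∣? coeffs v k))

  ¬Dependence⇒LinIndep : ∀ {S} → ¬ Dependence S → LinIndep p M S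
  ¬Dependence⇒LinIndep {S} ¬dep c c-supp c-rel k with p ∣? c k
  ... | yes p∣ck = p∣ck
  ... | no  p∤ck = contradiction (v , v-supp , v-rel , k , p∤ck ∘ p∣r⇒p∣c k) ¬dep
    where
    open DivMod
    v : Vec (Fin p) n
    v = tabulate (λ k → remainder (c k divMod p))
    c≡q*p+v : ∀ k → c k ≡ quotient (c k divMod p) * p + coeffs v k
    c≡q*p+v k = begin
      c k                                         ≡⟨ property (c k divMod p) ⟩
      toℕ (remainder (c k divMod p)) + q * p      ≡⟨ +-comm (toℕ (remainder (c k divMod p))) (q * p) ⟩
      q * p + toℕ (remainder (c k divMod p))      ≡⟨ cong (λ r → q * p + toℕ r) (lookup∘tabulate _ k) ⟨
      q * p + coeffs v k                          ∎
      where
      open ≡-Reasoning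
      q = quotient (c k divMod p)
    p∣r⇒p∣c : ∀ k → p ∣ coeffs v k → p ∣ c k
    p∣r⇒p∣c k p∣r = subst (p ∣_) (sym (c≡q*p+v k)) (∣m∣n⇒∣m+n (n∣m*n (quotient (c k divMod p))) p∣r)
    v-supp : SupportedIn S (coeffs v)
    v-supp k k∉S = m+n≡0⇒n≡0 _ (trans (sym (c≡q*p+v k)) (c-supp k k∉S))
    v-rel : IsRelation p M (coeffs v)
    v-rel = IsRelation-cancel {b = λ k → quotient (c k divMod p) * p} c≡q*p+v (λ k → n∣m*n (quotient (c k divMod p))) c-rel

  LinIndep? : ∀ S → Dec (LinIndep p M S)
  LinIndep? S with Dependence? S
  ... | yes (v , v-supp , v-rel , k , p∤vk) = no λ indep → p∤vk (indep (coeffs v) v-supp v-rel k)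
  ... | no  ¬dep = yes (¬Dependence⇒LinIndep ¬dep)

  IndepOfSize : Pred ℕ 0ℓ
  IndepOfSize k = ∃ λ S → LinIndep p M S × ∣ S ∣ ≡ k

  rank-exists : ∃ λ r → HasRank p M r
  rank-exists with greatest IndepOfSize? n ∅-indep (λ { k (S , _ , ∣S∣≡k) → subst (_≤ n) ∣S∣≡k (∣p∣≤n S) })
    where
    IndepOfSize? : Decidable IndepOfSize
    IndepOfSize? k = anySubset? (λ S → LinIndep? S ×-dec (∣ S ∣ ≟ℕ k))
    ∅-indep : IndepOfSize 0
    ∅-indep = _ , (λ c c-supp _ k → subst (p ∣_) (sym (c-supp k ∉⊥)) (p ∣0)) , ∣⊥∣≡0 n
  ... | r , indep-r , maximal = r , indep-r , λ S indep → maximal ∣ S ∣ (S , indep , refl)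

-- Lists, subsets and weights

Unique⇒lookup-injective : ∀ {A : Set} {xs : List A} → Unique xs →
  ∀ {s t} → List.lookup xs s ≡ List.lookup xs t → s ≡ t
Unique⇒lookup-injective (_ ∷ _) {zero}  {zero}  _ = refl
Unique⇒lookup-injective (x≢ ∷ _) {zero}  {suc t} x≡ = contradiction x≡ (All.lookup x≢ (∈-lookup t))
Unique⇒lookup-injective (x≢ ∷ _) {suc s} {zero}  ≡x = contradiction (sym ≡x) (All.lookup x≢ (∈-lookup s))
Unique⇒lookup-injective (_ ∷ u) {suc s} {suc t} eq = cong suc (Unique⇒lookup-injective u eq)

module _ {A : Set} {P Q : Pred A 0ℓ} (P? : Decidable P) (Q? : Decidable Q) (P⇒Q : ∀ x → P x → Q x) where

  length-filter-mono : ∀ xs → length (filter P? xs) ≤ length (filter Q? xs)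
  length-filter-mono []       = z≤n
  length-filter-mono (x ∷ xs) with P? x | Q? x
  ... | yes _  | yes _  = s≤s (length-filter-mono xs)
  ... | yes Px | no ¬Qx = contradiction (P⇒Q x Px) ¬Qx
  ... | no _   | yes _  = m≤n⇒m≤1+n (length-filter-mono xs)
  ... | no _   | no _   = length-filter-mono xs

  length-filter-strict : ∀ {xs x₀} → x₀ ∈ₗ xs → Q x₀ → ¬ P x₀ →
    length (filter P? xs) < length (filter Q? xs)
  length-filter-strict {x ∷ xs} (here refl) Qx ¬Px with P? x | Q? x
  ... | yes Px | _      = contradiction Px ¬Px
  ... | no _   | yes _  = s≤s (length-filter-mono xs)
  ... | no _   | no ¬Qx = contradiction Qx ¬Qx
  length-filter-strict {x ∷ xs} (there x₀∈xs) Qx₀ ¬Px₀ with P? x | Q? x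
  ... | yes _  | yes _  = s≤s (length-filter-strict x₀∈xs Qx₀ ¬Px₀)
  ... | yes Px | no ¬Qx = contradiction (P⇒Q x Px) ¬Qx
  ... | no _   | yes _  = m≤n⇒m≤1+n (length-filter-strict x₀∈xs Qx₀ ¬Px₀)
  ... | no _   | no _   = length-filter-strict x₀∈xs Qx₀ ¬Px₀

∣p∣≡sumFin : ∀ {n} (S : Subset n) → ∣ S ∣ ≡ sumFin (λ k → ⟦ Vec.lookup S k ⟧)
∣p∣≡sumFin []          = refl
∣p∣≡sumFin (true  ∷ S) = cong suc (∣p∣≡sumFin S)
∣p∣≡sumFin (false ∷ S) = ∣p∣≡sumFin S

module _ {n : ℕ} where

  ∈-resp-lookup : ∀ {n′} {S : Subset n} {S′ : Subset n′} {k k′} →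
    Vec.lookup S k ≡ Vec.lookup S′ k′ → k ∈ S → k′ ∈ S′
  ∈-resp-lookup {S′ = S′} {k′ = k′} eq k∈S = lookup⇒[]= k′ S′ (trans (sym eq) ([]=⇒lookup k∈S))

  lookup≡false⇒∉ : ∀ {S : Subset n} {k} → Vec.lookup S k ≡ false → k ∉ S
  lookup≡false⇒∉ eq k∈S with trans (sym eq) ([]=⇒lookup k∈S)
  ... | ()

  x∉p[x]≔outside : (S : Subset n) (x : Fin n) → x ∉ S [ x ]≔ false
  x∉p[x]≔outside S x = lookup≡false⇒∉ (lookup∘update x S false)

  p[x]≔outside⊆p : (S : Subset n) (x : Fin n) → ∀ {k} → k ∈ S [ x ]≔ false → k ∈ S
  p[x]≔outside⊆p S x {k} k∈ with k ≟ x
  ... | yes refl = contradiction k∈ (x∉p[x]≔outside S x)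
  ... | no  k≢x  = ∈-resp-lookup (lookup∘update′ k≢x S false) k∈

∣p∣≤1+∣p[x]≔outside∣ : ∀ {n} (S : Subset n) (x : Fin n) → ∣ S ∣ ≤ suc ∣ S [ x ]≔ false ∣
∣p∣≤1+∣p[x]≔outside∣ (true  ∷ S) zero    = ≤-refl
∣p∣≤1+∣p[x]≔outside∣ (false ∷ S) zero    = n≤1+n _
∣p∣≤1+∣p[x]≔outside∣ (true  ∷ S) (suc x) = s≤s (∣p∣≤1+∣p[x]≔outside∣ S x)
∣p∣≤1+∣p[x]≔outside∣ (false ∷ S) (suc x) = ∣p∣≤1+∣p[x]≔outside∣ S x

weight<blockSize : ∀ p {m n} (M : Incidence m n) (j : Fin n) (w : Fin m → ℕ) →
  (∀ i → M i j ≡ false → p ∣ w i) → ∀ {i₀} → M i₀ j ≡ true → p ∣ w i₀ → weight p w < blockSize M j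
weight<blockSize p M j w p∣off {i₀} i₀∈B p∣wi₀ = length-filter-strict
  (λ i → ¬? (p ∣? w i)) (λ i → T? (M i j)) support⊆B (∈-allFin i₀) (subst T (sym i₀∈B) _) (λ p∤ → p∤ p∣wi₀)
  where
  support⊆B : ∀ i → ¬ p ∣ w i → T (M i j)
  support⊆B i p∤wi with M i j in eq
  ... | true  = _
  ... | false = p∤wi (p∣off i eq)

blockSize≡0 : ∀ {m n} (M : Incidence m n) (j : Fin n) → (∀ i → M i j ≡ false) → blockSize M j ≡ 0
blockSize≡0 {m} M j none = cong length (filter-none (λ i → T? (M i j)) {xs = allFin m} (All.tabulate λ {i} _ → subst T (none i)))

0<weight : ∀ {p m} (w : Fin m → ℕ) → ¬ (∀ i → p ∣ w i) → 0 < weight p w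
0<weight {p} {m} w ¬all with ¬∀⟶∃¬ m _ (λ i → p ∣? w i) ¬all
... | i , p∤wi = filter-some (λ i → ¬? (p ∣? w i)) (Any.map (λ { refl → p∤wi }) (∈-allFin i))

module _ {p m n d : ℕ} {M : Incidence m n} (minWeight : MinWeight p M d) where

  0<minWeight : 0 < d
  0<minWeight with proj₁ minWeight
  ... | c , ¬rel , weight≡d = subst (0 <_) weight≡d (0<weight (lincomb M c) ¬rel)

  light⇒relation : ∀ c → weight p (lincomb M c) < d → IsRelation p M c
  light⇒relation c light with all? (λ i → p ∣? lincomb M c i)
  ... | yes rel = rel
  ... | no ¬rel = contradiction (proj₂ minWeight c ¬rel) (<⇒≱ light)

module _ {p : ℕ} (p-prime : Prime p) where

  prime-∣-cancelˡ : ∀ {a b} → ¬ p ∣ a → p ∣ a * b → p ∣ b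
  prime-∣-cancelˡ {a} {b} p∤a p∣ab = [ (λ p∣a → contradiction p∣a p∤a) , id ]′ (euclidsLemma a b p-prime p∣ab)

  prime-∣-cancelʳ : ∀ {a b} → ¬ p ∣ b → p ∣ a * b → p ∣ a
  prime-∣-cancelʳ {a} {b} p∤b p∣ab = [ id , (λ p∣b → contradiction p∣b p∤b) ]′ (euclidsLemma a b p-prime p∣ab)

prime∤pred : ∀ {q} → Prime (suc q) → ¬ suc q ∣ q
prime∤pred {zero}  p-prime = contradiction p-prime ¬prime[1]
prime∤pred {suc q} _ p∣q = <-irrefl refl (∣⇒≤ p∣q)

-- The residual design

module Residual {m n} (A : Incidence m n) (j : Fin n) where

  m″ n″ : ℕ
  m″ = length (residualPoints A j)
  n″ = length (residualBlocks j)

  A″ : Incidence m″ n″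
  A″ = residual A j

  row : Fin m″ → Fin m
  row = List.lookup (residualPoints A j)

  col : Fin n″ → Fin n
  col = List.lookup (residualBlocks j)

  -- A with column j deleted; A″ consists of its rows outside the block.
  A₋ : Incidence m n″
  A₋ i t = A i (col t)

  row∉block : ∀ r → A (row r) j ≡ false
  row∉block r with A (row r) j | proj₂ (∈-filter⁻ (λ i → T? (not (A i j))) {xs = allFin m} (∈-lookup r))
  ... | false | _ = refl

  row-onto : ∀ {i} → A i j ≡ false → ∃ λ r → row r ≡ i
  row-onto {i} i∉B = _ , sym (lookup-index (∈-filter⁺ (λ i → T? (not (A i j))) (∈-allFin i) (subst (T ∘ not) (sym i∉B) _)))

  col≢j : ∀ t → col t ≢ j
  col≢j t = proj₂ (∈-filter⁻ (λ k → ¬? (k ≟ j)) {xs = allFin n} (∈-lookup t))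

  col-injective : ∀ {s t} → col s ≡ col t → s ≡ t
  col-injective = Unique⇒lookup-injective (filter⁺ (λ k → ¬? (k ≟ j)) (allFin⁺ n))

  colIndex : ∀ {k} → k ≢ j → Fin n″
  colIndex {k} k≢j = Any.index (∈-filter⁺ (λ k → ¬? (k ≟ j)) (∈-allFin k) k≢j)

  col∘colIndex : ∀ {k} (k≢j : k ≢ j) → col (colIndex k≢j) ≡ k
  col∘colIndex {k} k≢j = sym (lookup-index (∈-filter⁺ (λ k → ¬? (k ≟ j)) (∈-allFin k) k≢j))

  j-or-col : ∀ k → k ≡ j ⊎ ∃ λ t → col t ≡ k
  j-or-col k with k ≟ j
  ... | yes k≡j = inj₁ k≡j
  ... | no  k≢j = inj₂ (colIndex k≢j , col∘colIndex k≢j)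

  sumFin-split : (g : Fin n → ℕ) → sumFin g ≡ g j + sumFin (g ∘ col)
  sumFin-split g = begin
    sumFin g                                         ≡⟨ sumFin-pick j g ⟩
    g j + sumFin (vanishAt j g)                      ≡⟨ cong (g j +_) (sumFin-tabulate (vanishAt j g)) ⟩
    g j + sum (List.tabulate (vanishAt j g))         ≡⟨ cong (λ s → g j + sum s) (map-tabulate id (vanishAt j g)) ⟨
    g j + sum (List.map (vanishAt j g) (allFin n))   ≡⟨ cong (g j +_) (sum-vanishAt j g (allFin n)) ⟩
    g j + sum (List.map g (residualBlocks j))        ≡⟨ cong (g j +_) (sumFin-lookup (residualBlocks j) g) ⟨
    g j + sumFin (g ∘ col)                           ∎
    where open ≡-Reasoning

  lincomb-split : ∀ c i → lincomb A c i ≡ c j * ⟦ A i j ⟧ + lincomb A₋ (c ∘ col) i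
  lincomb-split c i = sumFin-split (λ k → c k * ⟦ A i k ⟧)

  extend : ∀ {B : Set} → B → (Fin n″ → B) → Fin n → B
  extend x c k with k ≟ j
  ... | yes _   = x
  ... | no  k≢j = c (colIndex k≢j)

  extend-j : ∀ {B : Set} (x : B) c → extend x c j ≡ x
  extend-j x c with j ≟ j
  ... | yes _   = refl
  ... | no  j≢j = contradiction refl j≢j

  extend-col : ∀ {B : Set} (x : B) c t → extend x c (col t) ≡ c t
  extend-col x c t with col t ≟ j
  ... | yes colt≡j = contradiction colt≡j (col≢j t)
  ... | no  colt≢j = cong c (col-injective (col∘colIndex colt≢j))

  extend-linear : ∀ a b x y (c c′ : Fin n″ → ℕ) k →
    extend (a * x + b * y) (λ t → a * c t + b * c′ t) k ≡ a * extend x c k + b * extend y c′ k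
  extend-linear a b x y c c′ k with k ≟ j
  ... | yes _ = refl
  ... | no  _ = refl

  lincomb-off : ∀ c {i} → A i j ≡ false → lincomb A c i ≡ lincomb A₋ (c ∘ col) i
  lincomb-off c {i} i∉B = begin
    lincomb A c i                                  ≡⟨ lincomb-split c i ⟩
    c j * ⟦ A i j ⟧ + lincomb A₋ (c ∘ col) i       ≡⟨ cong (λ b → c j * ⟦ b ⟧ + lincomb A₋ (c ∘ col) i) i∉B ⟩
    c j * 0 + lincomb A₋ (c ∘ col) i               ≡⟨ cong (_+ lincomb A₋ (c ∘ col) i) (*-zeroʳ (c j)) ⟩
    lincomb A₋ (c ∘ col) i                         ∎
    where open ≡-Reasoning

  lincomb-on : ∀ c {i} → A i j ≡ true → lincomb A c i ≡ c j + lincomb A₋ (c ∘ col) i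
  lincomb-on c {i} i∈B = begin
    lincomb A c i                                  ≡⟨ lincomb-split c i ⟩
    c j * ⟦ A i j ⟧ + lincomb A₋ (c ∘ col) i       ≡⟨ cong (λ b → c j * ⟦ b ⟧ + lincomb A₋ (c ∘ col) i) i∈B ⟩
    c j * 1 + lincomb A₋ (c ∘ col) i               ≡⟨ cong (_+ lincomb A₋ (c ∘ col) i) (*-identityʳ (c j)) ⟩
    c j + lincomb A₋ (c ∘ col) i                   ∎
    where open ≡-Reasoning

  lincomb-extend : ∀ x c i → lincomb A (extend x c) i ≡ x * ⟦ A i j ⟧ + lincomb A₋ c i
  lincomb-extend x c i = trans (lincomb-split (extend x c) i)
    (cong₂ (λ y s → y * ⟦ A i j ⟧ + s) (extend-j x c) (lincomb-cong A₋ (extend-col x c) i))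

  restrict : Subset n → Subset n″
  restrict S = tabulate (Vec.lookup S ∘ col)

  extendSet : Subset n″ → Subset n
  extendSet S″ = tabulate (extend true (Vec.lookup S″))

  lookup-restrict : ∀ S t → Vec.lookup (restrict S) t ≡ Vec.lookup S (col t)
  lookup-restrict S = lookup∘tabulate (Vec.lookup S ∘ col)

  ∈restrict⇒col∈ : ∀ {S t} → t ∈ restrict S → col t ∈ S
  ∈restrict⇒col∈ {S} {t} = ∈-resp-lookup (lookup-restrict S t)

  col∈⇒∈restrict : ∀ {S t} → col t ∈ S → t ∈ restrict S
  col∈⇒∈restrict {S} {t} = ∈-resp-lookup (sym (lookup-restrict S t))

  restrict∘extendSet : ∀ S″ → restrict (extendSet S″) ≡ S″
  restrict∘extendSet S″ = trans
    (tabulate-cong λ t → trans (lookup∘tabulate (extend true (Vec.lookup S″)) (col t)) (extend-col true (Vec.lookup S″) t))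
    (tabulate∘lookup S″)

  ∣S∣≡⟦j⟧+∣restrict∣ : ∀ S → ∣ S ∣ ≡ ⟦ Vec.lookup S j ⟧ + ∣ restrict S ∣
  ∣S∣≡⟦j⟧+∣restrict∣ S = begin
    ∣ S ∣                                                      ≡⟨ ∣p∣≡sumFin S ⟩
    sumFin (λ k → ⟦ Vec.lookup S k ⟧)                          ≡⟨ sumFin-split _ ⟩
    ⟦ Vec.lookup S j ⟧ + sumFin (λ t → ⟦ Vec.lookup S (col t) ⟧) ≡⟨ cong (⟦ Vec.lookup S j ⟧ +_) (sumFin-cong λ t → cong ⟦_⟧ (lookup-restrict S t)) ⟨
    ⟦ Vec.lookup S j ⟧ + sumFin (λ t → ⟦ Vec.lookup (restrict S) t ⟧) ≡⟨ cong (⟦ Vec.lookup S j ⟧ +_) (∣p∣≡sumFin (restrict S)) ⟨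
    ⟦ Vec.lookup S j ⟧ + ∣ restrict S ∣                         ∎
    where open ≡-Reasoning

  ∣extendSet∣ : ∀ S″ → ∣ extendSet S″ ∣ ≡ suc ∣ S″ ∣
  ∣extendSet∣ S″ = trans (∣S∣≡⟦j⟧+∣restrict∣ (extendSet S″)) (cong₂ (λ b S → ⟦ b ⟧ + ∣ S ∣)
    (trans (lookup∘tabulate (extend true (Vec.lookup S″)) j) (extend-j true (Vec.lookup S″))) (restrict∘extendSet S″))

module LinearEmbedding (pm : ℕ) (p-prime : Prime (suc pm)) {m n} (A : Incidence m n) (j : Fin n)
  {d} (minWeight : MinWeight (suc pm) A d) (∣B∣≡d : blockSize A j ≡ d) where

  open Residual A j

  -- Multiplication by pm is negation modulo p.
  p : ℕ
  p = suc pm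

  block-nonempty : ∃ λ i → A i j ≡ true
  block-nonempty with any? (λ i → A i j Bool.≟ true)
  ... | yes i∈B = i∈B
  ... | no  B≡∅ = contradiction (trans (sym ∣B∣≡d) (blockSize≡0 A j λ i → ¬-not λ i∈B → B≡∅ (i , i∈B)))
                                (≢-sym (<⇒≢ (0<minWeight minWeight)))

  -- With y = -w(i₀), the codeword u = y·(column j) + w vanishes at i₀ ∈ B and outside B, so it is
  -- lighter than the block.
  vanishingOffBlock⇒extends : ∀ c → (∀ i → A i j ≡ false → p ∣ lincomb A₋ c i) →
    ∃ λ y → IsRelation p A (extend y c)
  vanishingOffBlock⇒extends c p∣off with all? (λ i → p ∣? lincomb A₋ c i)
  ... | yes p∣w = 0 , λ i → subst (p ∣_) (sym (lincomb-extend 0 c i)) (p∣w i)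
  ... | no ¬p∣w with ¬∀⟶∃¬ m _ (λ i → p ∣? lincomb A₋ c i) ¬p∣w
  ...   | i₀ , p∤wi₀ = y , light⇒relation minWeight (extend y c)
                             (subst (weight p u <_) ∣B∣≡d (weight<blockSize p A j u p∣u-off i₀∈B p∣ui₀))
    where
    w u : Fin m → ℕ
    y : ℕ
    w = lincomb A₋ c
    y = pm * w i₀
    u = lincomb A (extend y c)
    i₀∈B : A i₀ j ≡ true
    i₀∈B with A i₀ j in eq
    ... | true  = refl
    ... | false = contradiction (p∣off i₀ eq) p∤wi₀
    p∣u-off : ∀ i → A i j ≡ false → p ∣ u i
    p∣u-off i i∉B = subst (p ∣_) (sym u≡w) (p∣off i i∉B)
      where
      u≡w : u i ≡ w i
      u≡w = begin
        u i                  ≡⟨ lincomb-extend y c i ⟩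
        y * ⟦ A i j ⟧ + w i  ≡⟨ cong (λ b → y * ⟦ b ⟧ + w i) i∉B ⟩
        y * 0 + w i          ≡⟨ cong (_+ w i) (*-zeroʳ y) ⟩
        w i                  ∎
        where open ≡-Reasoning
    p∣ui₀ : p ∣ u i₀
    p∣ui₀ = subst (p ∣_) (sym u≡p*w) (m∣m*n (w i₀))
      where
      pm*x*1+x≡p*x : ∀ pm x → pm * x * 1 + x ≡ suc pm * x
      pm*x*1+x≡p*x = solve-∀
      u≡p*w : u i₀ ≡ p * w i₀
      u≡p*w = begin
        u i₀                    ≡⟨ lincomb-extend y c i₀ ⟩
        y * ⟦ A i₀ j ⟧ + w i₀   ≡⟨ cong (λ b → y * ⟦ b ⟧ + w i₀) i₀∈B ⟩
        y * 1 + w i₀            ≡⟨ pm*x*1+x≡p*x pm (w i₀) ⟩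
        p * w i₀                ∎
        where open ≡-Reasoning

  relation-extends : ∀ c → IsRelation p A″ c → ∃ λ y → IsRelation p A (extend y c)
  relation-extends c c-rel = vanishingOffBlock⇒extends c λ i i∉B →
    subst (λ i → p ∣ lincomb A₋ c i) (proj₂ (row-onto i∉B)) (c-rel (proj₁ (row-onto i∉B)))

  extend-supported : ∀ {S x c} → (j ∉ S → p ∣ x) → SupportedIn (restrict S) c →
    ∀ k → k ∉ S → p ∣ extend x c k
  extend-supported {S} p∣x c-supp k k∉S with k ≟ j
  ... | yes refl = p∣x k∉S
  ... | no  k≢j  = subst (p ∣_) (sym (c-supp _ t∉restrict)) (p ∣0)
    where
    t∉restrict : colIndex k≢j ∉ restrict S
    t∉restrict t∈ = k∉S (subst (_∈ S) (col∘colIndex k≢j) (∈restrict⇒col∈ t∈))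

  extendSet-indep : ∀ {S″} → LinIndep p A″ S″ → LinIndep p A (extendSet S″)
  extendSet-indep {S″} indep c c-supp c-rel k =
    [ (λ { refl → p∣cj }) , (λ { (t , refl) → p∣c∘col t }) ]′ (j-or-col k)
    where
    c∘col-supp : SupportedIn S″ (c ∘ col)
    c∘col-supp t t∉S″ = c-supp (col t) λ colt∈ →
      t∉S″ (subst (t ∈_) (restrict∘extendSet S″) (col∈⇒∈restrict colt∈))
    p∣c∘col : ∀ t → p ∣ c (col t)
    p∣c∘col = indep (c ∘ col) c∘col-supp λ r → subst (p ∣_) (lincomb-off c (row∉block r)) (c-rel (row r))
    p∣cj : p ∣ c j
    p∣cj = ∣m+n∣m⇒∣n
      (subst (p ∣_) (trans (lincomb-on c (proj₂ block-nonempty)) (+-comm (c j) _)) (c-rel (proj₁ block-nonempty)))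
      (lincomb-∣ A₋ (c ∘ col) p∣c∘col (proj₁ block-nonempty))

  restrict-indep : ∀ {S} → LinIndep p A S → j ∈ S → LinIndep p A″ (restrict S)
  restrict-indep indep j∈S c c-supp c-rel t with relation-extends c c-rel
  ... | y , y-rel = subst (p ∣_) (extend-col y c t)
    (LinIndep⇒LinIndepMod indep (extend y c) (extend-supported (contradiction j∈S) c-supp) y-rel (col t))

  -- A relation of A″ on restrict S extends with a coefficient x at j, and x ≢ 0 unless it is
  -- trivial; so these relations form a line, and dropping a coordinate t₀ of one of them kills all.
  restrict-indep-dropping : ∀ {S} → LinIndep p A S → j ∉ S →
    ∀ {c t₀} → SupportedIn (restrict S) c → IsRelation p A″ c → ¬ p ∣ c t₀ →
    LinIndep p A″ (restrict S [ t₀ ]≔ false)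
  restrict-indep-dropping {S} indep j∉S {c} {t₀} c-supp c-rel p∤ct₀ c′ c′-supp c′-rel t =
    prime-∣-cancelˡ p-prime p∤x (∣m+n∣m⇒∣n (subst (p ∣_) (+-comm _ (pm * y * c t)) (p∣e t)) (p∣pm*y*c t))
    where
    indepMod : LinIndepMod p A S
    indepMod = LinIndep⇒LinIndepMod indep
    x y : ℕ
    x = proj₁ (relation-extends c c-rel)
    y = proj₁ (relation-extends c′ c′-rel)
    x-rel : IsRelation p A (extend x c)
    x-rel = proj₂ (relation-extends c c-rel)
    y-rel : IsRelation p A (extend y c′)
    y-rel = proj₂ (relation-extends c′ c′-rel)
    p∤x : ¬ p ∣ x
    p∤x p∣x = p∤ct₀ (subst (p ∣_) (extend-col x c t₀)
      (indepMod (extend x c) (extend-supported (λ _ → p∣x) c-supp) x-rel (col t₀)))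
    c″ : Fin n″ → ℕ
    c″ t = x * c′ t + pm * y * c t
    c″-supp : SupportedIn (restrict S) c″
    c″-supp t t∉ = trans
      (cong₂ (λ a b → x * a + pm * y * b) (c′-supp t (t∉ ∘ p[x]≔outside⊆p (restrict S) t₀)) (c-supp t t∉))
      (cong₂ _+_ (*-zeroʳ x) (*-zeroʳ (pm * y)))
    xy+pm*y*x≡p*xy : ∀ pm x y → x * y + pm * y * x ≡ suc pm * (x * y)
    xy+pm*y*x≡p*xy = solve-∀
    e : Fin n → ℕ
    e = extend (x * y + pm * y * x) c″
    e-rel : IsRelation p A e
    e-rel = IsRelation-cong (λ k → sym (extend-linear x (pm * y) y x c′ c k))
      (IsRelation-linear {M = A} x (pm * y) y-rel x-rel)
    p∣ej : p ∣ x * y + pm * y * x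
    p∣ej = subst (p ∣_) (sym (xy+pm*y*x≡p*xy pm x y)) (m∣m*n (x * y))
    p∣e : ∀ t → p ∣ c″ t
    p∣e t = subst (p ∣_) (extend-col _ c″ t) (indepMod e (extend-supported (λ _ → p∣ej) c″-supp) e-rel (col t))
    c″t₀≡pm*y*ct₀ : c″ t₀ ≡ pm * y * c t₀
    c″t₀≡pm*y*ct₀ = trans
      (cong (λ a → x * a + pm * y * c t₀) (c′-supp t₀ (x∉p[x]≔outside (restrict S) t₀)))
      (cong (_+ pm * y * c t₀) (*-zeroʳ x))
    p∣y : p ∣ y
    p∣y = prime-∣-cancelˡ p-prime (prime∤pred p-prime)
      (prime-∣-cancelʳ p-prime p∤ct₀ (subst (p ∣_) c″t₀≡pm*y*ct₀ (p∣e t₀)))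
    p∣pm*y*c : ∀ t → p ∣ pm * y * c t
    p∣pm*y*c t = ∣m⇒∣m*n (c t) (∣n⇒∣m*n pm p∣y)

  rank-bound : ∀ {r} → HasRank p A″ r → ∀ {S} → LinIndep p A S → ∣ S ∣ ≤ suc r
  rank-bound {r} (_ , maximal) {S} indep =
    subst (_≤ suc r) (sym (∣S∣≡⟦j⟧+∣restrict∣ S)) (bound (Vec.lookup S j) refl)
    where
    bound : ∀ b → Vec.lookup S j ≡ b → ⟦ b ⟧ + ∣ restrict S ∣ ≤ suc r
    bound true  S[j] = s≤s (maximal _ (restrict-indep indep (lookup⇒[]= j S S[j])))
    bound false S[j] with Dependence? p A″ (restrict S)
    ... | no ¬dep = m≤n⇒m≤1+n (maximal _ (¬Dependence⇒LinIndep p A″ ¬dep))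
    ... | yes (_ , v-supp , v-rel , t₀ , p∤vt₀) = ≤-trans (∣p∣≤1+∣p[x]≔outside∣ (restrict S) t₀)
          (s≤s (maximal _ (restrict-indep-dropping indep (lookup≡false⇒∉ S[j]) v-supp v-rel p∤vt₀)))

  linearlyEmbeddable : LinearlyEmbeddable p A j
  linearlyEmbeddable with rank-exists p A″
  ... | r , rank″@((S″ , indep″ , ∣S″∣≡r) , _) =
    r , ((extendSet S″ , extendSet-indep indep″ , trans (∣extendSet∣ S″) (cong suc ∣S″∣≡r))
        , λ S indep → rank-bound rank″ indep)
      , rank″

theorem2p2 : (v b : ℕ) (A : Incidence v b) (p : ℕ) → Prime p → (d : ℕ) →
    MinWeight p A d →
    (j : Fin b) → blockSize A j ≡ d →
    LinearlyEmbeddable p A j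
theorem2p2 v b A zero     p-prime d minWeight j ∣B∣≡d = contradiction p-prime ¬prime[0]
theorem2p2 v b A (suc pm) p-prime d minWeight j ∣B∣≡d =
  LinearEmbedding.linearlyEmbeddable pm p-prime A j minWeight ∣B∣≡d
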